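{- Let $G=(V,E)$ be an undirected graph with edge weights $w:E\to\{0,1,\dots,W\}$, let $r$ be an EC-SNDP requirement function with maximum requirement $k$, and let $t\ge1$ be an integer. Let $H$ be the output of the streaming greedy edge-fault-tolerant spanner algorithm (described in the context) run on the edges of $G$ in an arbitrary order with parameters $t$, $f=(2t-1)(2k-1)$ and $\epsilon=1/(2t-1)$. Then the optimal value of the cut-based LP relaxation of EC-SNDP on $(H,r)$ is at most $4t$ times the minimum weight of a feasible (integral) solution of the EC-SNDP instance $(G,r)$.
   Context: EC-SNDP: given $G=(V,E)$ with nonnegative edge weights and integers $r(uv)\ge0$ for unordered pairs $u,v\in V$, find a minimum-weight subgraph in which every pair $u,v$ has $r(uv)$ edge-disjoint paths; assume the instance on $G$ is feasible. Cut-based LP relaxation on a graph $(V,E')$: minimize $\sum_{e\in E'}w(e)x(e)$ subject to $\sum_{e\in\delta_{E'}(S)}x(e)\ge\max_{u\in S,v\in V\setminus S}r(uv)$ for all $\emptyset\ne S\subsetneq V$, and $0\le x(e)\le 1$, where $\delta_{E'}(S)$ is the set of edges of $E'$ with exactly one endpoint in $S$. Streaming greedy edge-fault-tolerant (EFT) spanner algorithm with parameters $(t,f,\epsilon)$: buckets $B_0=\{0\}$, $B_i=[(1+\epsilon)^{i-1},(1+\epsilon)^i)$ for $i=1,\dots,T$ covering $\{1,\dots,W\}$; start with $H_i=(V,\emptyset)$; for each arriving edge $(u,v)$ with $w(u,v)\in B_j$, add it to $H_j$ if there is a set $F$ of at most $f$ edges such that the unweighted (hop) distance between $u$ and $v$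 in $H_j$ with the edges of $F$ removed exceeds $2t-1$; output $H=\bigcup_i H_i$. -}

module Defs where

open import Data.Nat as ℕ using (ℕ; zero; suc)
open import Data.Integer using (+_)
open import Data.Rational using (ℚ; 0ℚ; 1ℚ; _+_; _*_; _/_; _≤_; _<_)
open import Data.Fin using (Fin; zero; suc) renaming (_<_ to _<F_)
open import Data.Bool using (Bool; true; false; _xor_; _∧_)
open import Data.List using (List; []; _∷_; length; concat)
open import Data.List.Membership.Propositional using (_∈_; _∉_)
open import Data.List.Relation.Unary.Unique.Propositional using (Unique)
open import Data.Vec using (Vec; lookup; toList)
open import Data.Product using (Σ; ∃; _×_; _,_)
open import Data.Sum using (_⊎_)
open import Relation.Binary.PropositionalEquality using (_≡_; _≢_)
open import Relation.Nullary using (¬_)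

ℕ→ℚ : ℕ → ℚ
ℕ→ℚ n = (+ n) / 1

_^ℚ_ : ℚ → ℕ → ℚ
q ^ℚ zero  = 1ℚ
q ^ℚ suc j = q * (q ^ℚ j)

sumFin : (m : ℕ) → (Fin m → ℚ) → ℚ
sumFin zero    g = 0ℚ
sumFin (suc m) g = g zero + sumFin m (λ i → g (suc i))

sumOver : {m : ℕ} → (Fin m → Bool) → (Fin m → ℚ) → ℚ
sumOver {m} S g = sumFin m (λ e → sel (S e) (g e))
  where
  sel : Bool → ℚ → ℚ
  sel true  q = q
  sel false q = 0ℚ

-- Graphs: vertex set Fin n, edges indexed by Fin m (the index order is
-- the arrival order of the stream), edge e joins src e and tgt e.

record Graph (n m : ℕ) : Set where
  field
    src tgt : Fin m → Fin n
    wt      : Fin m → ℕ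
open Graph public

Simple : {n m : ℕ} → Graph n m → Set
Simple G =
  (∀ e → src G e ≢ tgt G e) ×
  (∀ e e' → e ≢ e' →
     ¬ ((src G e ≡ src G e' × tgt G e ≡ tgt G e') ⊎
        (src G e ≡ tgt G e' × tgt G e ≡ src G e')))

Joins : {n m : ℕ} → Graph n m → Fin m → Fin n → Fin n → Set
Joins G e a b = (src G e ≡ a × tgt G e ≡ b) ⊎ (src G e ≡ b × tgt G e ≡ a)

data Walk {n m : ℕ} (G : Graph n m) (P : Fin m → Set) :
          Fin n → Fin n → List (Fin m) → Set where
  nil  : ∀ {a} → Walk G P a a []
  cons : ∀ {a x b es} (e : Fin m) → P e → Joins G e a x →
         Walk G P x b es → Walk G P a b (e ∷ es)

InSub : {m : ℕ} → (Fin m → Bool) → Fin m → Set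
InSub S e = S e ≡ true

EdgeDisjointPaths : {n m : ℕ} → Graph n m → (Fin m → Bool) →
                    Fin n → Fin n → ℕ → Set
EdgeDisjointPaths {n} {m} G S a b c =
  Σ (Vec (List (Fin m)) c) λ ps →
    (∀ i → Walk G (InSub S) a b (lookup ps i)) × Unique (concat (toList ps))

SNDPFeasible : {n m : ℕ} → Graph n m → (Fin n → Fin n → ℕ) →
               (Fin m → Bool) → Set
SNDPFeasible G r S = ∀ u v → u ≢ v → EdgeDisjointPaths G S u v (r u v)

weight : {n m : ℕ} → Graph n m → (Fin m → Bool) → ℚ
weight G S = sumOver S (λ e → ℕ→ℚ (wt G e))

-- k is the maximum requirement (over unordered pairs of distinct vertices;
-- k = 0 when there are no such pairs)
IsMaxReq : {n : ℕ} → (Fin n → Fin n → ℕ) → ℕ → Set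
IsMaxReq r k = (∀ u v → u ≢ v → r u v ℕ.≤ k) ×
               ((∃ λ u → ∃ λ v → u ≢ v × r u v ≡ k) ⊎ k ≡ 0)

Crosses : {n m : ℕ} → Graph n m → (Fin n → Bool) → Fin m → Bool
Crosses G C e = C (src G e) xor C (tgt G e)

cutSel : {n m : ℕ} → Graph n m → (Fin m → Bool) → (Fin n → Bool) →
         Fin m → Bool
cutSel G H C e = H e ∧ Crosses G C e

LPFeasible : {n m : ℕ} → Graph n m → (Fin n → Fin n → ℕ) →
             (Fin m → Bool) → (Fin m → ℚ) → Set
LPFeasible {n} {m} G r H x =
  (∀ e → 0ℚ ≤ x e × x e ≤ 1ℚ) ×
  (∀ (C : Fin n → Bool) u v → C u ≡ true → C v ≡ false →
     ℕ→ℚ (r u v) ≤ sumOver (cutSel G H C) x)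

LPCost : {n m : ℕ} → Graph n m → (Fin m → Bool) → (Fin m → ℚ) → ℚ
LPCost G H x = sumOver H (λ e → ℕ→ℚ (wt G e) * x e)

InBucket : ℚ → ℕ → ℕ → Set
InBucket b w zero    = w ≡ 0
InBucket b w (suc j) = (b ^ℚ j ≤ ℕ→ℚ w) × (ℕ→ℚ w < b ^ℚ suc j)

SameBucket : ℚ → ℕ → ℕ → Set
SameBucket b w w' = ∃ λ i → InBucket b w i × InBucket b w' i

-- the greedy algorithm with parameters (t, f, base b = 1+ε) outputs H:
-- edge e is kept iff there is a set F of at most f edges such that in
-- H_j (kept earlier edges of the same bucket as e) minus F, the hop
-- distance between the endpoints of e exceeds 2t-1, i.e. there is no
-- walk with at most 2t-1 edges.
GreedyOutput : {n m : ℕ} → Graph n m → ℕ → ℕ → ℚ → (Fin m → Bool) → Set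
GreedyOutput {n} {m} G t f b H =
  ∀ e → (H e ≡ true) ⇔
        (∃ λ (F : List (Fin m)) → length F ℕ.≤ f ×
          ¬ (∃ λ es → length es ℕ.≤ (2 ℕ.* t ℕ.∸ 1) ×
               Walk G (Hj e F) (src G e) (tgt G e) es))
  where
  _⇔_ : Set → Set → Set
  A ⇔ B = (A → B) × (B → A)
  Hj : Fin m → List (Fin m) → Fin m → Set
  Hj e F e' = (e' <F e) × (H e' ≡ true) ×
              SameBucket b (wt G e) (wt G e') × e' ∉ F

-- ε = 1/(2t-1), base 1+ε (t ≥ 1; value at t = 0 is irrelevant)
onePlusEps : ℕ → ℚ
onePlusEps zero     = 1ℚ
onePlusEps (suc t') = 1ℚ + (+ 1) / suc (2 ℕ.* t')

-- Let S be a feasible solution and k the maximum requirement. Every edge e ∈ S that the greedy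
-- algorithm rejected has, because the spanner tolerates (2t-1)(2k-1) edge faults, 2k pairwise
-- edge-disjoint detours in H, each with at most 2t-1 edges of weight at most 2t/(2t-1)·w(e)
-- (same bucket); so the detours of e weigh at most 2k·2t·w(e) in total. Put
--   x(f) = min(1, [f ∈ S ∩ H] + load(f)/(k+1)),
-- where load(f) counts the detours through f: its cost is at most 4t·w(S).
-- For a cut separating u and v with r(uv) ≤ k, call a crossing edge f of H saturated if x(f) = 1.
-- If r(uv) crossing edges are saturated the cut constraint holds. Otherwise each of the r(uv)
-- edge-disjoint u–v paths of S crosses the cut at a kept edge (which is saturated) or at a
-- rejected edge e, whose 2k crossing detours meet at most k-1 saturated edges and so put load at
-- least k+1 on unsaturated crossing edges. Everything is scaled by k+1 so that it happens in ℕ.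

module Submission where

open import Defs
open import Level using (0ℓ)
open import Function using (_∘_)
open import Data.Product using (Σ; ∃; _×_; _,_; proj₁; proj₂)
open import Data.Sum using (_⊎_; inj₁; inj₂)
open import Relation.Binary.PropositionalEquality
open import Relation.Nullary using (¬_; Dec; yes; no; does; ¬?; contradiction)
open import Relation.Nullary.Decidable using (_×-dec_; _⊎-dec_; dec-true)
open import Relation.Unary using (Pred; Decidable; _⊆_; _∖_)

open import Data.Bool as Bool using (Bool; true; false; _∧_; _∨_; not; _xor_)
open import Data.Bool.Properties using (∧-assoc)
open import Data.Nat using (ℕ; zero; suc; _+_; _*_; _∸_; _⊓_; _≤_; _<_; z≤n; s≤s; NonZero)
open import Data.Nat.Properties hiding (_≟_)
open import Data.Nat.ListAction using (sum)
open import Data.Nat.Tactic.RingSolver renaming (solve-∀ to ℕ-solve-∀)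
open import Data.Fin as Fin using (Fin; zero; suc; _≟_)
open import Data.Fin.Properties using (any?)
open import Data.List using (List; []; _∷_; map; concat; _++_; length)
open import Data.List.Properties using (length-++)
open import Data.List.Membership.Propositional using (_∈_; _∉_)
open import Data.List.Membership.Propositional.Properties using (∈-++⁺ˡ; ∈-++⁺ʳ)
open import Data.List.Relation.Unary.Any using (here; there)
open import Data.List.Relation.Unary.All as All using (All; []; _∷_)
open import Data.List.Relation.Unary.AllPairs using (_∷_)
open import Data.List.Relation.Unary.Unique.Propositional using (Unique)
open import Data.Vec using (toList)
open import Data.Vec.Properties using (length-toList)
open import Data.Vec.Relation.Unary.All.Properties using (lookup⁻; toList⁺)
import Data.Integer as ℤ
import Data.Integer.Properties as ℤ
open import Data.Integer.Tactic.RingSolver renaming (solve-∀ to ℤ-solve-∀)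
open import Data.Rational as ℚ using (ℚ; 0ℚ; 1ℚ; toℚᵘ) renaming (_≤_ to _≤ℚ_; _*_ to _*ℚ_)
import Data.Rational.Properties as ℚ
open import Data.Rational.Unnormalised as ℚᵘ using (mkℚᵘ; _≃_; *≡*; *≤*; *<*)
import Data.Rational.Unnormalised.Properties as ℚᵘ

open import Algebra.Properties.Semiring.Sum +-*-semiring
  using (sum-syntax; ∑-distrib-+; ∑-comm; *-distribˡ-sum; sum-cong-≗; sum-replicate-zero)
open import Algebra.Properties.CommutativeSemigroup *-commutativeSemigroup using (x∙yz≈y∙xz)

𝟙[_] : Bool → ℕ
𝟙[ true ]  = 1
𝟙[ false ] = 0

𝟙-∨ : ∀ a b → 𝟙[ a ∨ b ] ≤ 𝟙[ a ] + 𝟙[ b ]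
𝟙-∨ true  b = s≤s z≤n
𝟙-∨ false b = ≤-refl

𝟙-split : ∀ a b → 𝟙[ a ] ≡ 𝟙[ a ∧ b ] + 𝟙[ a ∧ not b ]
𝟙-split true  true  = refl
𝟙-split true  false = refl
𝟙-split false b     = refl

≢⇒xor-true : ∀ {a b} → a ≢ b → a xor b ≡ true
≢⇒xor-true {true}  {true}  a≢b = contradiction refl a≢b
≢⇒xor-true {true}  {false} _   = refl
≢⇒xor-true {false} {true}  _   = refl
≢⇒xor-true {false} {false} a≢b = contradiction refl a≢b

xor-true⇒≢ : ∀ {a b} → a xor b ≡ true → a ≢ b
xor-true⇒≢ {true}  {false} _ ()
xor-true⇒≢ {false} {true}  _ ()

∧-true : ∀ {a b} → a ∧ b ≡ true → a ≡ true × b ≡ true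
∧-true {true} {true} _ = refl , refl

∧-not-true : ∀ {a b} → a ∧ not b ≡ true → b ≡ false
∧-not-true {true} {false} _ = refl

𝟙-mono : ∀ {a b} → (a ≡ true → b ≡ true) → 𝟙[ a ] ≤ 𝟙[ b ]
𝟙-mono {false}         _   = z≤n
𝟙-mono {true}  {true}  _   = ≤-refl
𝟙-mono {true}  {false} a⇒b with a⇒b refl
... | ()

𝟙*≤𝟙 : ∀ {a b k} → k ≤ 1 → (a ≡ true → b ≡ true) → 𝟙[ a ] * k ≤ 𝟙[ b ]
𝟙*≤𝟙 {false}       _   _   = z≤n
𝟙*≤𝟙 {true} {k = k} k≤1 a⇒b = ≤-trans (≤-reflexive (*-identityˡ k)) (≤-trans k≤1 (𝟙-mono a⇒b))

∑-mono-≤ : ∀ m {f g : Fin m → ℕ} → (∀ i → f i ≤ g i) → ∑[ i < m ] f i ≤ ∑[ i < m ] g i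
∑-mono-≤ zero    f≤g = z≤n
∑-mono-≤ (suc m) f≤g = +-mono-≤ (f≤g zero) (∑-mono-≤ m (f≤g ∘ suc))

term≤∑ : ∀ m (f : Fin m → ℕ) i → f i ≤ ∑[ j < m ] f j
term≤∑ (suc m) f zero    = m≤m+n (f zero) _
term≤∑ (suc m) f (suc i) = ≤-trans (term≤∑ m (f ∘ suc) i) (m≤n+m _ (f zero))

∑-*ˡ : ∀ m c (f : Fin m → ℕ) → ∑[ i < m ] (c * f i) ≡ c * ∑[ i < m ] f i
∑-*ˡ m c f = sym (*-distribˡ-sum c f)

∑-𝟙-split : ∀ m (a b : Fin m → Bool) (f : Fin m → ℕ) →
  ∑[ i < m ] (𝟙[ a i ] * f i) ≡ ∑[ i < m ] (𝟙[ a i ∧ b i ] * f i) + ∑[ i < m ] (𝟙[ a i ∧ not (b i) ] * f i)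
∑-𝟙-split m a b f = trans
  (sum-cong-≗ λ i → trans (cong (_* f i) (𝟙-split (a i) (b i))) (*-distribʳ-+ (f i) 𝟙[ a i ∧ b i ] _))
  (∑-distrib-+ (λ i → 𝟙[ a i ∧ b i ] * f i) _)

∑-indicator : ∀ m (g : Fin m → ℕ) x → ∑[ e < m ] (g e * 𝟙[ does (e ≟ x) ]) ≡ g x
∑-indicator (suc m) g zero = begin
  g zero * 1 + ∑[ e < m ] (g (suc e) * 0)  ≡⟨ cong₂ _+_ (*-identityʳ (g zero)) (sum-cong-≗ (*-zeroʳ ∘ g ∘ suc)) ⟩
  g zero + ∑[ e < m ] 0                     ≡⟨ cong (g zero +_) (sum-replicate-zero m) ⟩
  g zero + 0                                ≡⟨ +-identityʳ (g zero) ⟩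
  g zero                                    ∎
  where open ≡-Reasoning
∑-indicator (suc m) g (suc x) =
  trans (cong (_+ ∑[ e < m ] (g (suc e) * 𝟙[ does (e ≟ x) ])) (*-zeroʳ (g zero)))
        (∑-indicator m (g ∘ suc) x)

sum-map-*ˡ : ∀ {A : Set} c (f : A → ℕ) xs → sum (map (λ x → c * f x) xs) ≡ c * sum (map f xs)
sum-map-*ˡ c f []       = sym (*-zeroʳ c)
sum-map-*ˡ c f (x ∷ xs) = trans (cong (c * f x +_) (sum-map-*ˡ c f xs)) (sym (*-distribˡ-+ c (f x) _))

sum-map-∑ : ∀ m {A : Set} (f : Fin m → A → ℕ) xs →
  sum (map (λ x → ∑[ e < m ] f e x) xs) ≡ ∑[ e < m ] sum (map (f e) xs)
sum-map-∑ m f []       = sym (sum-replicate-zero m)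
sum-map-∑ m f (x ∷ xs) =
  trans (cong (∑[ e < m ] f e x +_) (sum-map-∑ m f xs)) (sym (∑-distrib-+ (λ e → f e x) _))

sum-map≤length* : ∀ {A : Set} {f : A → ℕ} {c} {xs} → All (λ x → f x ≤ c) xs → sum (map f xs) ≤ length xs * c
sum-map≤length* []           = z≤n
sum-map≤length* (f≤c ∷ f≤cs) = +-mono-≤ f≤c (sum-map≤length* f≤cs)

length≤sum-map : ∀ {A : Set} {f : A → ℕ} {xs} → All (λ x → 1 ≤ f x) xs → length xs ≤ sum (map f xs)
length≤sum-map []           = z≤n
length≤sum-map (1≤f ∷ 1≤fs) = +-mono-≤ 1≤f (length≤sum-map 1≤fs)

Unique-++⁻ʳ : ∀ {A : Set} (xs : List A) {ys} → Unique (xs ++ ys) → Unique ys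
Unique-++⁻ʳ []       u       = u
Unique-++⁻ʳ (x ∷ xs) (_ ∷ u) = Unique-++⁻ʳ xs u

Unique-++⇒∉ : ∀ {A : Set} (xs : List A) {ys x} → Unique (xs ++ ys) → x ∈ xs → x ∉ ys
Unique-++⇒∉ (_ ∷ xs) (x∉ ∷ _) (here refl) x∈ys = All.lookup x∉ (∈-++⁺ʳ xs x∈ys) refl
Unique-++⇒∉ (_ ∷ xs) (_ ∷ u)  (there x∈xs) = Unique-++⇒∉ xs u x∈xs

-- How many walks of a family use an edge

module _ {m : ℕ} where
  open import Data.List.Membership.DecPropositional (_≟_ {m}) using (_∈?_)

  occurs : Fin m → List (Fin m) → ℕ
  occurs e p = 𝟙[ does (e ∈? p) ]

  occurs-∈ : ∀ {e p} → e ∈ p → occurs e p ≡ 1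
  occurs-∈ {e} {p} e∈p with e ∈? p
  ... | yes _   = refl
  ... | no e∉p  = contradiction e∈p e∉p

  occurs-∉ : ∀ {e p} → e ∉ p → occurs e p ≡ 0
  occurs-∉ {e} {p} e∉p with e ∈? p
  ... | yes e∈p = contradiction e∈p e∉p
  ... | no _    = refl

  multiplicity : Fin m → List (List (Fin m)) → ℕ
  multiplicity e ps = sum (map (occurs e) ps)

  EdgeDisjoint : List (List (Fin m)) → Set
  EdgeDisjoint ps = ∀ e → multiplicity e ps ≤ 1

  multiplicity-∉ : ∀ {e} ps → e ∉ concat ps → multiplicity e ps ≡ 0
  multiplicity-∉ []       _    = refl
  multiplicity-∉ (p ∷ ps) e∉ps =
    cong₂ _+_ (occurs-∉ {p = p} (e∉ps ∘ ∈-++⁺ˡ)) (multiplicity-∉ ps (e∉ps ∘ ∈-++⁺ʳ p))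

  EdgeDisjoint-∷ : ∀ {p ps} → EdgeDisjoint ps → (∀ {e} → e ∈ p → e ∉ concat ps) → EdgeDisjoint (p ∷ ps)
  EdgeDisjoint-∷ {p} {ps} disjoint p∩ps=∅ e with e ∈? p
  ... | yes e∈p rewrite multiplicity-∉ ps (p∩ps=∅ e∈p) = ≤-refl
  ... | no  _   = disjoint e

  Unique⇒EdgeDisjoint : ∀ ps → Unique (concat ps) → EdgeDisjoint ps
  Unique⇒EdgeDisjoint []       _ e = z≤n
  Unique⇒EdgeDisjoint (p ∷ ps) u =
    EdgeDisjoint-∷ {p = p} {ps} (Unique⇒EdgeDisjoint ps (Unique-++⁻ʳ p u)) (Unique-++⇒∉ p u)

  ∑-occurs≤sum : ∀ (g : Fin m → ℕ) p → ∑[ e < m ] (g e * occurs e p) ≤ sum (map g p)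
  ∑-occurs≤sum g []       = ≤-reflexive (trans (sum-cong-≗ (*-zeroʳ ∘ g)) (sum-replicate-zero m))
  ∑-occurs≤sum g (x ∷ p) = begin
    ∑[ e < m ] (g e * occurs e (x ∷ p))
      ≤⟨ ∑-mono-≤ m (λ e → *-monoʳ-≤ (g e) (𝟙-∨ (does (e ≟ x)) (does (e ∈? p)))) ⟩
    ∑[ e < m ] (g e * (𝟙[ does (e ≟ x) ] + occurs e p))
      ≡⟨ sum-cong-≗ (λ e → *-distribˡ-+ (g e) _ (occurs e p)) ⟩
    ∑[ e < m ] (g e * 𝟙[ does (e ≟ x) ] + g e * occurs e p)
      ≡⟨ ∑-distrib-+ (λ e → g e * 𝟙[ does (e ≟ x) ]) _ ⟩
    ∑[ e < m ] (g e * 𝟙[ does (e ≟ x) ]) + ∑[ e < m ] (g e * occurs e p)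
      ≤⟨ +-mono-≤ (≤-reflexive (∑-indicator m g x)) (∑-occurs≤sum g p) ⟩
    g x + sum (map g p) ∎
    where open ≤-Reasoning

  ≤∑-occurs : ∀ (g : Fin m → ℕ) p {e} → e ∈ p → g e ≤ ∑[ e′ < m ] (g e′ * occurs e′ p)
  ≤∑-occurs g p {e} e∈p = begin
    g e               ≡⟨ *-identityʳ (g e) ⟨
    g e * 1           ≡⟨ cong (g e *_) (occurs-∈ e∈p) ⟨
    g e * occurs e p  ≤⟨ term≤∑ m (λ e′ → g e′ * occurs e′ p) e ⟩
    ∑[ e′ < m ] (g e′ * occurs e′ p) ∎
    where open ≤-Reasoning

  ∑-multiplicity : ∀ (g : Fin m → ℕ) ps →
    ∑[ e < m ] (g e * multiplicity e ps) ≡ sum (map (λ p → ∑[ e < m ] (g e * occurs e p)) ps)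
  ∑-multiplicity g ps = begin
    ∑[ e < m ] (g e * multiplicity e ps)                  ≡⟨ sum-cong-≗ (λ e → sym (sum-map-*ˡ (g e) (occurs e) ps)) ⟩
    ∑[ e < m ] (sum (map (λ p → g e * occurs e p) ps))    ≡⟨ sum-map-∑ m (λ e p → g e * occurs e p) ps ⟨
    sum (map (λ p → ∑[ e < m ] (g e * occurs e p)) ps)    ∎
    where open ≡-Reasoning

-- Short walks

module _ {n m : ℕ} (G : Graph n m) where

  walk-map : ∀ {P Q : Pred (Fin m) 0ℓ} {a b es} → P ⊆ Q → Walk G P a b es → Walk G Q a b es
  walk-map P⊆Q nil                 = nil
  walk-map P⊆Q (cons e Pe joins w) = cons e (P⊆Q Pe) joins (walk-map P⊆Q w)

  walk-All : ∀ {P a b es} → Walk G P a b es → All P es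
  walk-All nil                 = []
  walk-All (cons e Pe joins w) = Pe ∷ walk-All w

  walk-crosses : ∀ {P a b es} (C : Fin n → Bool) → Walk G P a b es → C a ≢ C b →
                 ∃ λ e → e ∈ es × Crosses G C e ≡ true
  walk-crosses C nil Ca≢Cb = contradiction refl Ca≢Cb
  walk-crosses {a = a} C (cons {x = x} e Pe joins w) Ca≢Cb with C a Bool.≟ C x
  ... | yes Ca≡Cx = let (e′ , e′∈es , crosses) = walk-crosses C w (Ca≢Cb ∘ trans Ca≡Cx) in
                    e′ , there e′∈es , crosses
  ... | no Ca≢Cx with joins
  ...   | inj₁ (refl , refl) = e , here refl , ≢⇒xor-true Ca≢Cx
  ...   | inj₂ (refl , refl) = e , here refl , ≢⇒xor-true (Ca≢Cx ∘ sym)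

  IsShortWalk : Pred (Fin m) 0ℓ → ℕ → Fin n → Fin n → List (Fin m) → Set
  IsShortWalk P ℓ a b es = length es ≤ ℓ × Walk G P a b es

  ShortWalk : Pred (Fin m) 0ℓ → ℕ → Fin n → Fin n → Set
  ShortWalk P ℓ a b = ∃ (IsShortWalk P ℓ a b)

  shortWalk? : ∀ {P} → Decidable P → ∀ ℓ a b → Dec (ShortWalk P ℓ a b)
  shortWalk? P? ℓ a b with a Fin.≟ b
  ... | yes refl = yes ([] , z≤n , nil)
  shortWalk? P? zero a b | no a≢b = no λ { ([] , _ , nil) → a≢b refl ; (_ ∷ _ , () , _) }
  shortWalk? {P} P? (suc ℓ) a b | no a≢b with any? firstEdge?
    where
    firstEdge? : ∀ e → Dec (P e × ((src G e ≡ a × ShortWalk P ℓ (tgt G e) b) ⊎ (tgt G e ≡ a × ShortWalk P ℓ (src G e) b)))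
    firstEdge? e = P? e ×-dec ((src G e Fin.≟ a ×-dec shortWalk? P? ℓ (tgt G e) b)
                          ⊎-dec (tgt G e Fin.≟ a ×-dec shortWalk? P? ℓ (src G e) b))
  ... | yes (e , Pe , inj₁ (refl , es , |es| , w)) = yes (e ∷ es , s≤s |es| , cons e Pe (inj₁ (refl , refl)) w)
  ... | yes (e , Pe , inj₂ (refl , es , |es| , w)) = yes (e ∷ es , s≤s |es| , cons e Pe (inj₂ (refl , refl)) w)
  ... | no none = no λ where
        ([] , _ , nil) → a≢b refl
        (e ∷ es , s≤s |es| , cons e Pe (inj₁ (refl , refl)) w) → none (e , Pe , inj₁ (refl , es , |es| , w))
        (e ∷ es , s≤s |es| , cons e Pe (inj₂ (refl , refl)) w) → none (e , Pe , inj₂ (refl , es , |es| , w))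

  disjointShortWalks : ∀ {P} ℓ i {a b} →
    (∀ F → length F ≤ (i ∸ 1) * ℓ → ShortWalk (P ∖ (_∈ F)) ℓ a b) →
    ∃ λ ps → length ps ≡ i × All (IsShortWalk P ℓ a b) ps × EdgeDisjoint ps
  disjointShortWalks {P} ℓ i {a} {b} avoiding = let (ps , family , _) = walks i ≤-refl in ps , family
    where
    walks : ∀ j → j ≤ i → ∃ λ ps → (length ps ≡ j × All (IsShortWalk P ℓ a b) ps × EdgeDisjoint ps)
                                 × length (concat ps) ≤ j * ℓ
    walks zero    _   = [] , (refl , [] , λ _ → z≤n) , z≤n
    walks (suc j) j<i =
      let (ps , (|ps| , short , disjoint) , |F|) = walks j (<⇒≤ j<i)
          (p , |p| , walk) = avoiding (concat ps) (≤-trans |F| (*-monoˡ-≤ ℓ (∸-monoˡ-≤ 1 j<i)))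
          p∖F = walk-All walk
      in p ∷ ps
       , (cong suc |ps| , (|p| , walk-map proj₁ walk) ∷ short
         , EdgeDisjoint-∷ {p = p} {ps} disjoint (proj₂ ∘ All.lookup p∖F))
       , ≤-trans (≤-reflexive (length-++ p)) (+-mono-≤ |p| |F|)

  length≤∑-crossing-multiplicity : ∀ {P a b} (C : Fin n → Bool) (g : Fin m → ℕ) → C a ≢ C b →
    (∀ {e} → P e → Crosses G C e ≡ true → 1 ≤ g e) →
    ∀ {ps} → All (Walk G P a b) ps → length ps ≤ ∑[ e < m ] (g e * multiplicity e ps)
  length≤∑-crossing-multiplicity {P} {a} {b} C g Ca≢Cb crossing⇒1≤g {ps} walks = begin
    length ps                                          ≤⟨ length≤sum-map (All.map crosses walks) ⟩
    sum (map (λ p → ∑[ e < m ] (g e * occurs e p)) ps) ≡⟨ ∑-multiplicity g ps ⟨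
    ∑[ e < m ] (g e * multiplicity e ps)               ∎
    where
    open ≤-Reasoning
    crosses : ∀ {p} → Walk G P a b p → 1 ≤ ∑[ e < m ] (g e * occurs e p)
    crosses {p} w = let (e , e∈p , e-crosses) = walk-crosses C w Ca≢Cb in
      ≤-trans (crossing⇒1≤g (All.lookup (walk-All w) e∈p) e-crosses) (≤∑-occurs g p e∈p)

  ∑-multiplicity≤ : ∀ {P a b} ℓ .{{_ : NonZero ℓ}} (g : Fin m → ℕ) c → (∀ {e} → P e → ℓ * g e ≤ c) →
    ∀ {ps} → All (IsShortWalk P ℓ a b) ps → ∑[ e < m ] (g e * multiplicity e ps) ≤ length ps * c
  ∑-multiplicity≤ {P} {a} {b} ℓ g c light {ps} short = begin
    ∑[ e < m ] (g e * multiplicity e ps)               ≡⟨ ∑-multiplicity g ps ⟩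
    sum (map (λ p → ∑[ e < m ] (g e * occurs e p)) ps) ≤⟨ sum-map≤length* (All.map weight≤c short) ⟩
    length ps * c                                      ∎
    where
    open ≤-Reasoning
    weight≤c : ∀ {p} → IsShortWalk P ℓ a b p → ∑[ e < m ] (g e * occurs e p) ≤ c
    weight≤c {p} (|p| , w) = ≤-trans (∑-occurs≤sum g p) (*-cancelˡ-≤ ℓ (begin
      ℓ * sum (map g p)            ≡⟨ sum-map-*ˡ ℓ g p ⟨
      sum (map (λ e → ℓ * g e) p)  ≤⟨ sum-map≤length* (All.map light (walk-All w)) ⟩
      length p * c                 ≤⟨ *-monoˡ-≤ c |p| ⟩
      ℓ * c                        ∎))

toℚᵘ-ℕ→ℚ : ∀ a → toℚᵘ (ℕ→ℚ a) ≃ mkℚᵘ (ℤ.+ a) 0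
toℚᵘ-ℕ→ℚ a = ℚ.toℚᵘ-fromℚᵘ (mkℚᵘ (ℤ.+ a) 0)

ℕ→ℚ-homo-+ : ∀ a b → ℕ→ℚ (a + b) ≡ ℕ→ℚ a ℚ.+ ℕ→ℚ b
ℕ→ℚ-homo-+ a b = ℚ.toℚᵘ-injective (begin
  toℚᵘ (ℕ→ℚ (a + b))
    ≈⟨ toℚᵘ-ℕ→ℚ (a + b) ⟩
  mkℚᵘ (ℤ.+ (a + b)) 0
    ≈⟨ *≡* (trans (cong (ℤ._* ℤ.+ 1) (ℤ.pos-+ a b)) (unit-denominators (ℤ.+ a) (ℤ.+ b))) ⟩
  mkℚᵘ (ℤ.+ a) 0 ℚᵘ.+ mkℚᵘ (ℤ.+ b) 0
    ≈⟨ ℚᵘ.+-cong (toℚᵘ-ℕ→ℚ a) (toℚᵘ-ℕ→ℚ b) ⟨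
  toℚᵘ (ℕ→ℚ a) ℚᵘ.+ toℚᵘ (ℕ→ℚ b)
    ≈⟨ ℚ.toℚᵘ-homo-+ (ℕ→ℚ a) (ℕ→ℚ b) ⟨
  toℚᵘ (ℕ→ℚ a ℚ.+ ℕ→ℚ b) ∎)
  where
  open ℚᵘ.≃-Reasoning
  unit-denominators : ∀ i j → (i ℤ.+ j) ℤ.* ℤ.+ 1 ≡ (i ℤ.* ℤ.+ 1 ℤ.+ j ℤ.* ℤ.+ 1) ℤ.* ℤ.+ 1
  unit-denominators = ℤ-solve-∀

ℕ→ℚ-homo-* : ∀ a b → ℕ→ℚ (a * b) ≡ ℕ→ℚ a ℚ.* ℕ→ℚ b
ℕ→ℚ-homo-* a b = ℚ.toℚᵘ-injective (begin
  toℚᵘ (ℕ→ℚ (a * b))                   ≈⟨ toℚᵘ-ℕ→ℚ (a * b) ⟩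
  mkℚᵘ (ℤ.+ (a * b)) 0                 ≈⟨ *≡* (cong (ℤ._* ℤ.+ 1) (ℤ.pos-* a b)) ⟩
  mkℚᵘ (ℤ.+ a) 0 ℚᵘ.* mkℚᵘ (ℤ.+ b) 0   ≈⟨ ℚᵘ.*-cong (toℚᵘ-ℕ→ℚ a) (toℚᵘ-ℕ→ℚ b) ⟨
  toℚᵘ (ℕ→ℚ a) ℚᵘ.* toℚᵘ (ℕ→ℚ b)       ≈⟨ ℚ.toℚᵘ-homo-* (ℕ→ℚ a) (ℕ→ℚ b) ⟨
  toℚᵘ (ℕ→ℚ a ℚ.* ℕ→ℚ b)               ∎)
  where open ℚᵘ.≃-Reasoning

ℕ→ℚ-mono-≤ : ∀ {a b} → a ≤ b → ℕ→ℚ a ℚ.≤ ℕ→ℚ b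
ℕ→ℚ-mono-≤ {a} {b} a≤b = ℚ.toℚᵘ-cancel-≤ (begin
  toℚᵘ (ℕ→ℚ a)    ≃⟨ toℚᵘ-ℕ→ℚ a ⟩
  mkℚᵘ (ℤ.+ a) 0  ≤⟨ *≤* (ℤ.*-monoʳ-≤-nonNeg (ℤ.+ 1) (ℤ.+≤+ a≤b)) ⟩
  mkℚᵘ (ℤ.+ b) 0  ≃⟨ toℚᵘ-ℕ→ℚ b ⟨
  toℚᵘ (ℕ→ℚ b)    ∎)
  where open ℚᵘ.≤-Reasoning

ℕ→ℚ-mono-< : ∀ {a b} → a < b → ℕ→ℚ a ℚ.< ℕ→ℚ b
ℕ→ℚ-mono-< {a} {b} a<b = ℚ.toℚᵘ-cancel-< (begin-strict
  toℚᵘ (ℕ→ℚ a)    ≃⟨ toℚᵘ-ℕ→ℚ a ⟩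
  mkℚᵘ (ℤ.+ a) 0  <⟨ *<* (ℤ.*-monoʳ-<-pos (ℤ.+ 1) (ℤ.+<+ a<b)) ⟩
  mkℚᵘ (ℤ.+ b) 0  ≃⟨ toℚᵘ-ℕ→ℚ b ⟨
  toℚᵘ (ℕ→ℚ b)    ∎)
  where open ℚᵘ.≤-Reasoning

ℕ→ℚ-cancel-≤ : ∀ {a b} → ℕ→ℚ a ℚ.≤ ℕ→ℚ b → a ≤ b
ℕ→ℚ-cancel-≤ a≤b = ≮⇒≥ (λ b<a → ℚ.<-irrefl refl (ℚ.<-≤-trans (ℕ→ℚ-mono-< b<a) a≤b))

ℕ→ℚ-*-reciprocal : ∀ d → ℕ→ℚ (suc d) ℚ.* (ℤ.+ 1 ℚ./ suc d) ≡ 1ℚ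
ℕ→ℚ-*-reciprocal d = ℚ.toℚᵘ-injective (begin
  toℚᵘ (ℕ→ℚ (suc d) ℚ.* q)                 ≈⟨ ℚ.toℚᵘ-homo-* (ℕ→ℚ (suc d)) q ⟩
  toℚᵘ (ℕ→ℚ (suc d)) ℚᵘ.* toℚᵘ q           ≈⟨ ℚᵘ.*-cong (toℚᵘ-ℕ→ℚ (suc d)) (ℚ.toℚᵘ-fromℚᵘ (mkℚᵘ (ℤ.+ 1) d)) ⟩
  mkℚᵘ (ℤ.+ suc d) 0 ℚᵘ.* mkℚᵘ (ℤ.+ 1) d   ≈⟨ *≡* (cong (λ k → ℤ.+ suc k) (denominators d)) ⟩
  toℚᵘ 1ℚ                                  ∎)
  where
  open ℚᵘ.≃-Reasoning
  q : ℚ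
  q = ℤ.+ 1 ℚ./ suc d
  denominators : ∀ d → d * 1 * 1 ≡ d + 0 * suc d + 0 * suc (d + 0 * suc d)
  denominators = ℕ-solve-∀

0≤reciprocal : ∀ d → 0ℚ ℚ.≤ ℤ.+ 1 ℚ./ suc d
0≤reciprocal d = ℚ.toℚᵘ-cancel-≤
  (ℚᵘ.≤-respʳ-≃ (ℚᵘ.≃-sym (ℚ.toℚᵘ-fromℚᵘ (mkℚᵘ (ℤ.+ 1) d))) (*≤* (ℤ.+≤+ z≤n)))

sumOver-ℕ→ℚ : ∀ {m} (S : Fin m → Bool) {h : Fin m → ℚ} (g : Fin m → ℕ) q → (∀ e → h e ≡ ℕ→ℚ (g e) ℚ.* q) →
  sumOver S h ≡ ℕ→ℚ (∑[ e < m ] (𝟙[ S e ] * g e)) ℚ.* q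
sumOver-ℕ→ℚ {zero}  S g q _ = sym (ℚ.*-zeroˡ q)
sumOver-ℕ→ℚ {suc m} S g q h≡gq with S zero | sumOver-ℕ→ℚ (S ∘ suc) (g ∘ suc) q (h≡gq ∘ suc)
... | false | sum≡ = trans (ℚ.+-identityˡ _) sum≡
... | true  | sum≡ = trans (cong₂ ℚ._+_ (h≡gq zero) sum≡) (begin
  ℕ→ℚ (g zero) ℚ.* q ℚ.+ ℕ→ℚ rest ℚ.* q      ≡⟨ ℚ.*-distribʳ-+ q (ℕ→ℚ (g zero)) (ℕ→ℚ rest) ⟨
  (ℕ→ℚ (g zero) ℚ.+ ℕ→ℚ rest) ℚ.* q          ≡⟨ cong (ℚ._* q) (ℕ→ℚ-homo-+ (g zero) rest) ⟨
  ℕ→ℚ (g zero + rest) ℚ.* q                   ≡⟨ cong (λ a → ℕ→ℚ (a + rest) ℚ.* q) (+-identityʳ (g zero)) ⟨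
  ℕ→ℚ (1 * g zero + rest) ℚ.* q               ∎)
  where
  open ≡-Reasoning
  rest : ℕ
  rest = ∑[ e < m ] (𝟙[ S (suc e) ] * g (suc e))

-- Fractional solutions from integral ones

module _ {n m : ℕ} (G : Graph n m) (r : Fin n → Fin n → ℕ) (H S : Fin m → Bool) where

  scaledIntegralSolution : ∀ k (X : Fin m → ℕ) c → (∀ e → X e ≤ suc k) →
    (∀ C u v → C u ≡ true → C v ≡ false → suc k * r u v ≤ ∑[ e < m ] (𝟙[ cutSel G H C e ] * X e)) →
    ∑[ e < m ] (𝟙[ H e ] * (wt G e * X e)) ≤ suc k * (c * ∑[ e < m ] (𝟙[ S e ] * wt G e)) →
    ∃ λ x → LPFeasible G r H x × LPCost G H x ℚ.≤ ℕ→ℚ c ℚ.* weight G S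
  scaledIntegralSolution k X c X≤K K*r≤cut cost≤ = x , (bounds , cuts) , costBound
    where
    open ℚ.≤-Reasoning
    K : ℕ
    K = suc k
    q : ℚ
    q = ℤ.+ 1 ℚ./ K
    instance
      q-nonNeg : ℚ.NonNegative q
      q-nonNeg = ℚ.nonNegative (0≤reciprocal k)

    x : Fin m → ℚ
    x e = ℕ→ℚ (X e) ℚ.* q

    ℕ→ℚ-mono-≤-scaled : ∀ {a b} → a ≤ b → ℕ→ℚ a ℚ.* q ℚ.≤ ℕ→ℚ b ℚ.* q
    ℕ→ℚ-mono-≤-scaled a≤b = ℚ.*-monoʳ-≤-nonNeg q (ℕ→ℚ-mono-≤ a≤b)

    ℕ→ℚ≡scaled : ∀ a → ℕ→ℚ a ≡ ℕ→ℚ (K * a) ℚ.* q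
    ℕ→ℚ≡scaled a = begin-equality
      ℕ→ℚ a                       ≡⟨ ℚ.*-identityʳ (ℕ→ℚ a) ⟨
      ℕ→ℚ a ℚ.* 1ℚ                ≡⟨ cong (ℕ→ℚ a ℚ.*_) (ℕ→ℚ-*-reciprocal k) ⟨
      ℕ→ℚ a ℚ.* (ℕ→ℚ K ℚ.* q)     ≡⟨ ℚ.*-assoc (ℕ→ℚ a) (ℕ→ℚ K) q ⟨
      ℕ→ℚ a ℚ.* ℕ→ℚ K ℚ.* q       ≡⟨ cong (ℚ._* q) (ℕ→ℚ-homo-* a K) ⟨
      ℕ→ℚ (a * K) ℚ.* q           ≡⟨ cong (λ b → ℕ→ℚ b ℚ.* q) (*-comm a K) ⟩
      ℕ→ℚ (K * a) ℚ.* q           ∎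

    bounds : ∀ e → 0ℚ ℚ.≤ x e × x e ℚ.≤ 1ℚ
    bounds e = ℚ.≤-trans (ℚ.≤-reflexive (sym (ℚ.*-zeroˡ q))) (ℕ→ℚ-mono-≤-scaled {0} {X e} z≤n)
             , ℚ.≤-trans (ℕ→ℚ-mono-≤-scaled (X≤K e)) (ℚ.≤-reflexive (ℕ→ℚ-*-reciprocal k))

    cuts : ∀ C u v → C u ≡ true → C v ≡ false → ℕ→ℚ (r u v) ℚ.≤ sumOver (cutSel G H C) x
    cuts C u v Cu Cv = begin
      ℕ→ℚ (r u v)                                          ≡⟨ ℕ→ℚ≡scaled (r u v) ⟩
      ℕ→ℚ (K * r u v) ℚ.* q                                ≤⟨ ℕ→ℚ-mono-≤-scaled (K*r≤cut C u v Cu Cv) ⟩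
      ℕ→ℚ (∑[ e < m ] (𝟙[ cutSel G H C e ] * X e)) ℚ.* q   ≡⟨ sumOver-ℕ→ℚ (cutSel G H C) X q (λ _ → refl) ⟨
      sumOver (cutSel G H C) x                             ∎

    weightS : ℕ
    weightS = ∑[ e < m ] (𝟙[ S e ] * wt G e)

    costBound : LPCost G H x ℚ.≤ ℕ→ℚ c ℚ.* weight G S
    costBound = begin
      LPCost G H x                                       ≡⟨ sumOver-ℕ→ℚ H (λ e → wt G e * X e) q wX≡ ⟩
      ℕ→ℚ (∑[ e < m ] (𝟙[ H e ] * (wt G e * X e))) ℚ.* q ≤⟨ ℕ→ℚ-mono-≤-scaled cost≤ ⟩
      ℕ→ℚ (K * (c * weightS)) ℚ.* q                      ≡⟨ ℕ→ℚ≡scaled (c * weightS) ⟨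
      ℕ→ℚ (c * weightS)                                  ≡⟨ ℕ→ℚ-homo-* c weightS ⟩
      ℕ→ℚ c ℚ.* ℕ→ℚ weightS                              ≡⟨ cong (ℕ→ℚ c ℚ.*_) weight≡ ⟨
      ℕ→ℚ c ℚ.* weight G S                               ∎
      where
      wX≡ : ∀ e → ℕ→ℚ (wt G e) ℚ.* x e ≡ ℕ→ℚ (wt G e * X e) ℚ.* q
      wX≡ e = trans (sym (ℚ.*-assoc (ℕ→ℚ (wt G e)) (ℕ→ℚ (X e)) q))
                    (cong (ℚ._* q) (sym (ℕ→ℚ-homo-* (wt G e) (X e))))
      weight≡ : weight G S ≡ ℕ→ℚ weightS
      weight≡ = trans (sumOver-ℕ→ℚ S (wt G) 1ℚ (λ e → sym (ℚ.*-identityʳ _))) (ℚ.*-identityʳ _)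

-- Detours of rejected edges

sameBucket⇒≤ : ∀ {b w w′} → 0ℚ ℚ.≤ b → SameBucket b w w′ → ℕ→ℚ w′ ℚ.≤ b ℚ.* ℕ→ℚ w
sameBucket⇒≤ {b} 0≤b (zero , refl , refl) = ℚ.≤-reflexive (sym (ℚ.*-zeroʳ b))
sameBucket⇒≤ {b} 0≤b (suc j , (b^j≤w , _) , (_ , w′<b^[j+1])) =
  ℚ.<⇒≤ (ℚ.<-≤-trans w′<b^[j+1] (ℚ.*-monoˡ-≤-nonNeg b {{ℚ.nonNegative 0≤b}} b^j≤w))

sameBucket-1+1/ℓ : ∀ d {w w′} → SameBucket (1ℚ ℚ.+ ℤ.+ 1 ℚ./ suc d) w w′ → suc d * w′ ≤ suc (suc d) * w
sameBucket-1+1/ℓ d {w} {w′} same = ℕ→ℚ-cancel-≤ (begin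
  ℕ→ℚ (ℓ * w′)                ≡⟨ ℕ→ℚ-homo-* ℓ w′ ⟩
  ℕ→ℚ ℓ ℚ.* ℕ→ℚ w′            ≤⟨ ℚ.*-monoˡ-≤-nonNeg (ℕ→ℚ ℓ) (sameBucket⇒≤ 0≤b same) ⟩
  ℕ→ℚ ℓ ℚ.* (b ℚ.* ℕ→ℚ w)     ≡⟨ ℚ.*-assoc (ℕ→ℚ ℓ) b (ℕ→ℚ w) ⟨
  ℕ→ℚ ℓ ℚ.* b ℚ.* ℕ→ℚ w       ≡⟨ cong (ℚ._* ℕ→ℚ w) ℓb≡ℓ+1 ⟩
  ℕ→ℚ (suc ℓ) ℚ.* ℕ→ℚ w       ≡⟨ ℕ→ℚ-homo-* (suc ℓ) w ⟨
  ℕ→ℚ (suc ℓ * w)             ∎)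
  where
  open ℚ.≤-Reasoning
  ℓ : ℕ
  ℓ = suc d
  b : ℚ
  b = 1ℚ ℚ.+ ℤ.+ 1 ℚ./ ℓ
  0≤b : 0ℚ ℚ.≤ b
  0≤b = ℚ.+-mono-≤ (ℕ→ℚ-mono-≤ {0} {1} z≤n) (0≤reciprocal d)
  instance
    ℓ-nonNeg : ℚ.NonNegative (ℕ→ℚ ℓ)
    ℓ-nonNeg = ℚ.nonNegative (ℕ→ℚ-mono-≤ {0} {ℓ} z≤n)
  ℓb≡ℓ+1 : ℕ→ℚ ℓ ℚ.* b ≡ ℕ→ℚ (suc ℓ)
  ℓb≡ℓ+1 = begin-equality
    ℕ→ℚ ℓ ℚ.* (1ℚ ℚ.+ ℤ.+ 1 ℚ./ ℓ)
      ≡⟨ ℚ.*-distribˡ-+ (ℕ→ℚ ℓ) 1ℚ _ ⟩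
    ℕ→ℚ ℓ ℚ.* 1ℚ ℚ.+ ℕ→ℚ ℓ ℚ.* (ℤ.+ 1 ℚ./ ℓ)
      ≡⟨ cong₂ ℚ._+_ (ℚ.*-identityʳ (ℕ→ℚ ℓ)) (ℕ→ℚ-*-reciprocal d) ⟩
    ℕ→ℚ ℓ ℚ.+ ℕ→ℚ 1
      ≡⟨ ℕ→ℚ-homo-+ ℓ 1 ⟨
    ℕ→ℚ (ℓ + 1)
      ≡⟨ cong ℕ→ℚ (+-comm ℓ 1) ⟩
    ℕ→ℚ (suc ℓ) ∎

module _ {n m : ℕ} (G : Graph n m) (H : Fin m → Bool) where
  open import Data.List.Membership.DecPropositional (_≟_ {m}) using (_∈?_)

  Light : ℕ → Fin m → Pred (Fin m) 0ℓ
  Light ℓ e e′ = H e′ ≡ true × ℓ * wt G e′ ≤ suc ℓ * wt G e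

  light? : ∀ ℓ e F → Decidable (Light ℓ e ∖ (_∈ F))
  light? ℓ e F e′ = ((H e′ Bool.≟ true) ×-dec (ℓ * wt G e′ ≤? suc ℓ * wt G e)) ×-dec ¬? (e′ ∈? F)

  Detours : ℕ → ℕ → Fin m → List (List (Fin m)) → Set
  Detours ℓ k e ps =
    length ps ≡ 2 * k × All (IsShortWalk G (Light ℓ e) ℓ (src G e) (tgt G e)) ps × EdgeDisjoint ps

  greedy⇒lightDetour : ∀ t′ k →
    GreedyOutput G (suc t′) ((2 * suc t′ ∸ 1) * (2 * k ∸ 1)) (onePlusEps (suc t′)) H →
    ∀ e → H e ≡ false → ∀ F → length F ≤ (2 * k ∸ 1) * suc (2 * t′) →
    ShortWalk G (Light (suc (2 * t′)) e ∖ (_∈ F)) (suc (2 * t′)) (src G e) (tgt G e)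
  greedy⇒lightDetour t′ k greedy e He≡false F |F|
    with shortWalk? G (light? (suc (2 * t′)) e F) (suc (2 * t′)) (src G e) (tgt G e)
  ... | yes detour = detour
  -- otherwise F would make the greedy algorithm keep e
  ... | no ∄detour with trans (sym He≡false) (proj₂ (greedy e) (F , |F|′ , ∄keptDetour))
    where
    hops : 2 * suc t′ ∸ 1 ≡ suc (2 * t′)
    hops = cong (_∸ 1) (*-suc 2 t′)
    |F|′ : length F ≤ (2 * suc t′ ∸ 1) * (2 * k ∸ 1)
    |F|′ = subst (λ h → length F ≤ h * (2 * k ∸ 1)) (sym hops) (≤-trans |F| (≤-reflexive (*-comm _ (suc (2 * t′)))))
    Kept : Pred (Fin m) 0ℓ
    Kept e′ = e′ Fin.< e × H e′ ≡ true × SameBucket (onePlusEps (suc t′)) (wt G e) (wt G e′) × e′ ∉ F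
    kept⇒light : Kept ⊆ Light (suc (2 * t′)) e ∖ (_∈ F)
    kept⇒light (_ , He′ , sameBucket , e′∉F) = (He′ , sameBucket-1+1/ℓ (2 * t′) sameBucket) , e′∉F
    ∄keptDetour : ¬ ∃ λ es → length es ≤ 2 * suc t′ ∸ 1 × Walk G Kept (src G e) (tgt G e) es
    ∄keptDetour (es , |es| , walk) = ∄detour (es , subst (length es ≤_) hops |es| , walk-map G kept⇒light walk)
  ... | ()

  detourFamilies : ∀ ℓ k →
    (∀ e → H e ≡ false → ∀ F → length F ≤ (2 * k ∸ 1) * ℓ →
       ShortWalk G (Light ℓ e ∖ (_∈ F)) ℓ (src G e) (tgt G e)) →
    Σ (Fin m → List (List (Fin m))) λ detours → ∀ e → H e ≡ false → Detours ℓ k e (detours e)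
  detourFamilies ℓ k avoiding = (λ e → proj₁ (family e (H e) refl)) , (λ e → proj₂ (family e (H e) refl))
    where
    family : ∀ e h → H e ≡ h → Σ (List (List (Fin m))) λ ps → h ≡ false → Detours ℓ k e ps
    family e true  _  = [] , λ ()
    family e false He = let (ps , detours) = disjointShortWalks G ℓ (2 * k) (avoiding e He) in ps , λ _ → detours

-- The load argument

module DetourLoad {n m : ℕ} (G : Graph n m) (H S : Fin m → Bool) (ℓ k : ℕ) .{{_ : NonZero ℓ}}
  (detours : Fin m → List (List (Fin m))) (detours-ok : ∀ e → H e ≡ false → Detours G H ℓ k e (detours e))
  where

  K : ℕ
  K = suc k

  missing : Fin m → Bool
  missing e = S e ∧ not (H e)

  load : Fin m → ℕ
  load e′ = ∑[ e < m ] (𝟙[ missing e ] * multiplicity e′ (detours e))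

  demand : Fin m → ℕ
  demand e′ = K * 𝟙[ S e′ ∧ H e′ ] + load e′

  X : Fin m → ℕ
  X e′ = K ⊓ demand e′

  X≤K : ∀ e → X e ≤ K
  X≤K e = m⊓n≤m K (demand e)

  ∑-*-load : ∀ (g : Fin m → ℕ) →
    ∑[ e′ < m ] (g e′ * load e′) ≡ ∑[ e < m ] (𝟙[ missing e ] * ∑[ e′ < m ] (g e′ * multiplicity e′ (detours e)))
  ∑-*-load g = begin
    ∑[ e′ < m ] (g e′ * load e′)
      ≡⟨ sum-cong-≗ (λ e′ → *-distribˡ-sum (g e′) (λ e → 𝟙[ missing e ] * multiplicity e′ (detours e))) ⟩
    ∑[ e′ < m ] ∑[ e < m ] (g e′ * (𝟙[ missing e ] * multiplicity e′ (detours e)))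
      ≡⟨ ∑-comm (λ e′ e → g e′ * (𝟙[ missing e ] * multiplicity e′ (detours e))) ⟩
    ∑[ e < m ] ∑[ e′ < m ] (g e′ * (𝟙[ missing e ] * multiplicity e′ (detours e)))
      ≡⟨ sum-cong-≗ (λ e → sum-cong-≗ (λ e′ → x∙yz≈y∙xz (g e′) 𝟙[ missing e ] _)) ⟩
    ∑[ e < m ] ∑[ e′ < m ] (𝟙[ missing e ] * (g e′ * multiplicity e′ (detours e)))
      ≡⟨ sum-cong-≗ (λ e → ∑-*ˡ m 𝟙[ missing e ] _) ⟩
    ∑[ e < m ] (𝟙[ missing e ] * ∑[ e′ < m ] (g e′ * multiplicity e′ (detours e))) ∎
    where open ≡-Reasoning

  detour-cost : ∀ e → 𝟙[ missing e ] * ∑[ e′ < m ] (wt G e′ * multiplicity e′ (detours e))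
                      ≤ 𝟙[ missing e ] * (2 * k * (suc ℓ * wt G e))
  detour-cost e with missing e in isMissing
  ... | false = z≤n
  ... | true  = let (|detours| , short , _) = detours-ok e (∧-not-true isMissing) in *-monoʳ-≤ 1 (begin
    ∑[ e′ < m ] (wt G e′ * multiplicity e′ (detours e))
      ≤⟨ ∑-multiplicity≤ G ℓ (wt G) (suc ℓ * wt G e) proj₂ short ⟩
    length (detours e) * (suc ℓ * wt G e)
      ≡⟨ cong (_* (suc ℓ * wt G e)) |detours| ⟩
    2 * k * (suc ℓ * wt G e) ∎)
    where open ≤-Reasoning

  keptWeight : ℕ
  keptWeight = ∑[ e < m ] (𝟙[ S e ∧ H e ] * wt G e)

  missingWeight : ℕ
  missingWeight = ∑[ e < m ] (𝟙[ missing e ] * wt G e)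

  ∑-weight*load≤ : ∑[ e < m ] (wt G e * load e) ≤ 2 * k * suc ℓ * missingWeight
  ∑-weight*load≤ = begin
    ∑[ e < m ] (wt G e * load e)
      ≡⟨ ∑-*-load (wt G) ⟩
    ∑[ e < m ] (𝟙[ missing e ] * ∑[ e′ < m ] (wt G e′ * multiplicity e′ (detours e)))
      ≤⟨ ∑-mono-≤ m detour-cost ⟩
    ∑[ e < m ] (𝟙[ missing e ] * (2 * k * (suc ℓ * wt G e)))
      ≡⟨ sum-cong-≗ (λ e → regroup 𝟙[ missing e ] (2 * k) (suc ℓ) (wt G e)) ⟩
    ∑[ e < m ] (2 * k * suc ℓ * (𝟙[ missing e ] * wt G e))
      ≡⟨ ∑-*ˡ m (2 * k * suc ℓ) _ ⟩
    2 * k * suc ℓ * missingWeight ∎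
    where
    open ≤-Reasoning
    regroup : ∀ x a b y → x * (a * (b * y)) ≡ a * b * (x * y)
    regroup = ℕ-solve-∀

  kept-cost : ∀ h s w L → 𝟙[ h ] * (w * (K ⊓ (K * 𝟙[ s ∧ h ] + L))) ≤ K * (𝟙[ s ∧ h ] * w) + w * L
  kept-cost false s w L = z≤n
  kept-cost true  s w L = begin
    1 * (w * (K ⊓ (K * i + L)))  ≡⟨ *-identityˡ _ ⟩
    w * (K ⊓ (K * i + L))        ≤⟨ *-monoʳ-≤ w (m⊓n≤n K _) ⟩
    w * (K * i + L)              ≡⟨ *-distribˡ-+ w (K * i) L ⟩
    w * (K * i) + w * L          ≡⟨ cong (_+ w * L) (trans (x∙yz≈y∙xz w K i) (cong (K *_) (*-comm w i))) ⟩
    K * (i * w) + w * L          ∎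
    where
    open ≤-Reasoning
    i : ℕ
    i = 𝟙[ s ∧ true ]

  cost : ∑[ e < m ] (𝟙[ H e ] * (wt G e * X e)) ≤ K * (2 * suc ℓ * ∑[ e < m ] (𝟙[ S e ] * wt G e))
  cost = begin
    ∑[ e < m ] (𝟙[ H e ] * (wt G e * X e))
      ≤⟨ ∑-mono-≤ m (λ e → kept-cost (H e) (S e) (wt G e) (load e)) ⟩
    ∑[ e < m ] (K * (𝟙[ S e ∧ H e ] * wt G e) + wt G e * load e)
      ≡⟨ ∑-distrib-+ (λ e → K * (𝟙[ S e ∧ H e ] * wt G e)) _ ⟩
    ∑[ e < m ] (K * (𝟙[ S e ∧ H e ] * wt G e)) + ∑[ e < m ] (wt G e * load e)
      ≤⟨ +-mono-≤ (≤-reflexive (∑-*ˡ m K _)) ∑-weight*load≤ ⟩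
    K * keptWeight + 2 * k * suc ℓ * missingWeight
      ≤⟨ +-mono-≤ (*-monoʳ-≤ K (m≤n*m keptWeight (2 * suc ℓ)))
                  (*-monoˡ-≤ missingWeight (*-monoˡ-≤ (suc ℓ) (*-monoʳ-≤ 2 (n≤1+n k)))) ⟩
    K * (2 * suc ℓ * keptWeight) + 2 * K * suc ℓ * missingWeight
      ≡⟨ distribute K ℓ keptWeight missingWeight ⟩
    K * (2 * suc ℓ * (keptWeight + missingWeight))
      ≡⟨ cong (λ a → K * (2 * suc ℓ * a)) (∑-𝟙-split m S H (wt G)) ⟨
    K * (2 * suc ℓ * ∑[ e < m ] (𝟙[ S e ] * wt G e)) ∎
    where
    open ≤-Reasoning
    distribute : ∀ a l c d → a * (2 * suc l * c) + 2 * a * suc l * d ≡ a * (2 * suc l * (c + d))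
    distribute = ℕ-solve-∀

  saturated : Fin m → Bool
  saturated e′ = does (K ≤? demand e′)

  kept⇒saturated : ∀ {e} → S e ≡ true → H e ≡ true → saturated e ≡ true
  kept⇒saturated {e} Se He = dec-true (K ≤? demand e) (begin
    K                         ≡⟨ *-identityʳ K ⟨
    K * 1                     ≤⟨ *-monoʳ-≤ K (𝟙-mono (λ _ → cong₂ _∧_ Se He)) ⟩
    K * 𝟙[ S e ∧ H e ]        ≤⟨ m≤m+n _ (load e) ⟩
    demand e                  ∎)
    where open ≤-Reasoning

  cut-share : ∀ a {D L} → L ≤ D → (K≤D? : Dec (K ≤ D)) →
    K * 𝟙[ a ∧ does K≤D? ] + 𝟙[ a ∧ not (does K≤D?) ] * L ≤ 𝟙[ a ] * (K ⊓ D)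
  cut-share false _ _ = ≤-reflexive (trans (+-identityʳ (K * 0)) (*-zeroʳ K))
  cut-share true {D} {L} L≤D (yes K≤D) = begin
    K * 1 + 0 * L   ≡⟨ trans (+-identityʳ (K * 1)) (*-identityʳ K) ⟩
    K               ≡⟨ m≤n⇒m⊓n≡m K≤D ⟨
    K ⊓ D           ≡⟨ *-identityˡ (K ⊓ D) ⟨
    1 * (K ⊓ D)     ∎
    where open ≤-Reasoning
  cut-share true {D} {L} L≤D (no K≰D) = begin
    K * 0 + 1 * L   ≡⟨ cong₂ _+_ (*-zeroʳ K) (*-identityˡ L) ⟩
    L               ≤⟨ L≤D ⟩
    D               ≡⟨ m≥n⇒m⊓n≡n (<⇒≤ (≰⇒> K≰D)) ⟨
    K ⊓ D           ≡⟨ *-identityˡ (K ⊓ D) ⟨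
    1 * (K ⊓ D)     ∎
    where open ≤-Reasoning

  c+K≤2k : ∀ {c} → c < k → c + K ≤ 2 * k
  c+K≤2k {c} c<k = begin
    c + suc k    ≡⟨ +-suc c k ⟩
    suc c + k    ≤⟨ +-monoˡ-≤ k c<k ⟩
    k + k        ≡⟨ cong (k +_) (+-identityʳ k) ⟨
    2 * k        ∎
    where open ≤-Reasoning

  module _ (C : Fin n → Bool) where

    crossings : ℕ
    crossings = ∑[ e < m ] 𝟙[ cutSel G H C e ∧ saturated e ]

    unsaturatedLoad : ℕ
    unsaturatedLoad = ∑[ e < m ] (𝟙[ cutSel G H C e ∧ not (saturated e) ] * load e)

    crossings+unsaturatedLoad≤cut : K * crossings + unsaturatedLoad ≤ ∑[ e < m ] (𝟙[ cutSel G H C e ] * X e)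
    crossings+unsaturatedLoad≤cut = begin
      K * crossings + unsaturatedLoad
        ≡⟨ cong (_+ unsaturatedLoad) (∑-*ˡ m K _) ⟨
      ∑[ e < m ] (K * 𝟙[ cutSel G H C e ∧ saturated e ]) + unsaturatedLoad
        ≡⟨ ∑-distrib-+ (λ e → K * 𝟙[ cutSel G H C e ∧ saturated e ]) _ ⟨
      ∑[ e < m ] (K * 𝟙[ cutSel G H C e ∧ saturated e ] + 𝟙[ cutSel G H C e ∧ not (saturated e) ] * load e)
        ≤⟨ ∑-mono-≤ m (λ e → cut-share (cutSel G H C e) (m≤n+m (load e) _) (K ≤? demand e)) ⟩
      ∑[ e < m ] (𝟙[ cutSel G H C e ] * X e) ∎
      where open ≤-Reasoning

    unsaturatedDetourCrossings : Fin m → ℕ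
    unsaturatedDetourCrossings e =
      ∑[ e′ < m ] (𝟙[ cutSel G H C e′ ∧ not (saturated e′) ] * multiplicity e′ (detours e))

    K≤detour-crossings : crossings < k → ∀ e → Crosses G C e ≡ true → H e ≡ false →
      K ≤ unsaturatedDetourCrossings e
    K≤detour-crossings c<k e crosses He with detours-ok e He
    ... | |ps| , short , disjoint = +-cancelˡ-≤ crossings K _ (begin
      crossings + K
        ≤⟨ c+K≤2k c<k ⟩
      2 * k
        ≡⟨ |ps| ⟨
      length (detours e)
        ≤⟨ length≤∑-crossing-multiplicity G C (λ e′ → 𝟙[ cutSel G H C e′ ]) (xor-true⇒≢ crosses)
             (λ (He′ , _) crosses′ → 𝟙-mono (λ _ → cong₂ _∧_ He′ crosses′)) (All.map proj₂ short) ⟩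
      ∑[ e′ < m ] (𝟙[ cutSel G H C e′ ] * multiplicity e′ (detours e))
        ≡⟨ ∑-𝟙-split m (cutSel G H C) saturated (λ e′ → multiplicity e′ (detours e)) ⟩
      ∑[ e′ < m ] (𝟙[ cutSel G H C e′ ∧ saturated e′ ] * multiplicity e′ (detours e))
        + ∑[ e′ < m ] (𝟙[ cutSel G H C e′ ∧ not (saturated e′) ] * multiplicity e′ (detours e))
        ≤⟨ +-monoˡ-≤ _ (∑-mono-≤ m (λ e′ → 𝟙*≤𝟙 (disjoint e′) (λ x → x))) ⟩
      crossings + ∑[ e′ < m ] (𝟙[ cutSel G H C e′ ∧ not (saturated e′) ] * multiplicity e′ (detours e)) ∎)
      where open ≤-Reasoning

    missing-crossings≤unsaturatedLoad : crossings < k →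
      ∑[ e < m ] (𝟙[ Crosses G C e ∧ missing e ] * K) ≤ unsaturatedLoad
    missing-crossings≤unsaturatedLoad c<k = begin
      ∑[ e < m ] (𝟙[ Crosses G C e ∧ missing e ] * K)
        ≤⟨ ∑-mono-≤ m share ⟩
      ∑[ e < m ] (𝟙[ missing e ] * unsaturatedDetourCrossings e)
        ≡⟨ ∑-*-load (λ e′ → 𝟙[ cutSel G H C e′ ∧ not (saturated e′) ]) ⟨
      unsaturatedLoad ∎
      where
      open ≤-Reasoning
      share : ∀ e → 𝟙[ Crosses G C e ∧ missing e ] * K ≤ 𝟙[ missing e ] * unsaturatedDetourCrossings e
      share e with Crosses G C e in crosses | missing e in isMissing
      ... | false | _     = z≤n
      ... | true  | false = z≤n
      ... | true  | true  = *-monoʳ-≤ 1 (K≤detour-crossings c<k e crosses (∧-not-true isMissing))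

    solution-crossings : ∀ {u v R} → C u ≡ true → C v ≡ false → EdgeDisjointPaths G S u v R →
      R ≤ crossings + ∑[ e < m ] 𝟙[ Crosses G C e ∧ missing e ]
    solution-crossings {u} {v} {R} Cu Cv (qs , walks , unique) = begin
      R
        ≡⟨ length-toList qs ⟨
      length (toList qs)
        ≤⟨ length≤∑-crossing-multiplicity G C (λ e → 𝟙[ Crosses G C e ∧ S e ]) Cu≢Cv
             (λ Se crosses → 𝟙-mono (λ _ → cong₂ _∧_ crosses Se)) (toList⁺ (lookup⁻ {xs = qs} walks)) ⟩
      ∑[ e < m ] (𝟙[ Crosses G C e ∧ S e ] * multiplicity e (toList qs))
        ≡⟨ ∑-𝟙-split m (λ e → Crosses G C e ∧ S e) H (λ e → multiplicity e (toList qs)) ⟩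
      ∑[ e < m ] (𝟙[ (Crosses G C e ∧ S e) ∧ H e ] * multiplicity e (toList qs))
        + ∑[ e < m ] (𝟙[ (Crosses G C e ∧ S e) ∧ not (H e) ] * multiplicity e (toList qs))
        ≤⟨ +-mono-≤ (∑-mono-≤ m (λ e → 𝟙*≤𝟙 (disjoint e) kept-crossing⇒saturated))
                    (∑-mono-≤ m (λ e → 𝟙*≤𝟙 (disjoint e) (trans (sym (∧-assoc (Crosses G C e) (S e) _))))) ⟩
      crossings + ∑[ e < m ] 𝟙[ Crosses G C e ∧ missing e ] ∎
      where
      open ≤-Reasoning
      Cu≢Cv : C u ≢ C v
      Cu≢Cv Cu≡Cv = contradiction (trans (sym Cu) (trans Cu≡Cv Cv)) λ ()
      disjoint : EdgeDisjoint (toList qs)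
      disjoint = Unique⇒EdgeDisjoint (toList qs) unique
      kept-crossing⇒saturated : ∀ {e} → (Crosses G C e ∧ S e) ∧ H e ≡ true → cutSel G H C e ∧ saturated e ≡ true
      kept-crossing⇒saturated isKept =
        let (crosses∧Se , He) = ∧-true isKept ; (crosses , Se) = ∧-true crosses∧Se
        in cong₂ _∧_ (cong₂ _∧_ He crosses) (kept⇒saturated Se He)

    cutBound : ∀ {u v R} → C u ≡ true → C v ≡ false → R ≤ k → EdgeDisjointPaths G S u v R →
      K * R ≤ ∑[ e < m ] (𝟙[ cutSel G H C e ] * X e)
    cutBound {R = R} Cu Cv R≤k paths with R ≤? crossings
    ... | yes R≤c =
      ≤-trans (*-monoʳ-≤ K R≤c) (≤-trans (m≤m+n (K * crossings) unsaturatedLoad) crossings+unsaturatedLoad≤cut)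
    ... | no  R≰c = ≤-trans (begin
      K * R
        ≤⟨ *-monoʳ-≤ K (solution-crossings Cu Cv paths) ⟩
      K * (crossings + ∑[ e < m ] 𝟙[ Crosses G C e ∧ missing e ])
        ≡⟨ *-distribˡ-+ K crossings _ ⟩
      K * crossings + K * ∑[ e < m ] 𝟙[ Crosses G C e ∧ missing e ]
        ≡⟨ cong (K * crossings +_)
             (trans (sum-cong-≗ (λ e → *-comm 𝟙[ Crosses G C e ∧ missing e ] K)) (∑-*ˡ m K _)) ⟨
      K * crossings + ∑[ e < m ] (𝟙[ Crosses G C e ∧ missing e ] * K)
        ≤⟨ +-monoʳ-≤ (K * crossings) (missing-crossings≤unsaturatedLoad (<-≤-trans (≰⇒> R≰c) R≤k)) ⟩
      K * crossings + unsaturatedLoad ∎) crossings+unsaturatedLoad≤cut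
      where open ≤-Reasoning

2[2+2t]≡4[1+t] : ∀ t → 2 * suc (suc (2 * t)) ≡ 4 * suc t
2[2+2t]≡4[1+t] = ℕ-solve-∀

theorem3p6 : (n m : ℕ) (G : Graph n m) (W : ℕ) → Simple G →
    (∀ e → wt G e ≤ W) →
    (r : Fin n → Fin n → ℕ) → (∀ u v → r u v ≡ r v u) →
    (k : ℕ) → IsMaxReq r k →
    SNDPFeasible G r (λ _ → true) →
    (t : ℕ) → 1 ≤ t →
    (H : Fin m → Bool) →
    GreedyOutput G t ((2 * t ∸ 1) * (2 * k ∸ 1)) (onePlusEps t) H →
    (S : Fin m → Bool) → SNDPFeasible G r S →
    ∃ λ (x : Fin m → ℚ) → LPFeasible G r H x ×
      LPCost G H x ≤ℚ (ℕ→ℚ (4 * t) *ℚ weight G S)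
theorem3p6 n m G _ _ _ r _ k (r≤k , _) _ (suc t′) (s≤s z≤n) H greedy S feasible =
  scaledIntegralSolution G r H S k X (4 * suc t′) X≤K cut cost′
  where
  ℓ : ℕ
  ℓ = suc (2 * t′)
  detours : Σ (Fin m → List (List (Fin m))) λ ds → ∀ e → H e ≡ false → Detours G H ℓ k e (ds e)
  detours = detourFamilies G H ℓ k (greedy⇒lightDetour G H t′ k greedy)
  open DetourLoad G H S ℓ k (proj₁ detours) (proj₂ detours)
  cut : ∀ C u v → C u ≡ true → C v ≡ false → K * r u v ≤ ∑[ e < m ] (𝟙[ cutSel G H C e ] * X e)
  cut C u v Cu Cv = cutBound C Cu Cv (r≤k u v u≢v) (feasible u v u≢v)
    where
    u≢v : u ≢ v
    u≢v refl = contradiction (trans (sym Cu) Cv) λ ()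
  cost′ : ∑[ e < m ] (𝟙[ H e ] * (wt G e * X e)) ≤ K * (4 * suc t′ * ∑[ e < m ] (𝟙[ S e ] * wt G e))
  cost′ = ≤-trans cost (≤-reflexive (cong (λ c → K * (c * ∑[ e < m ] (𝟙[ S e ] * wt G e))) (2[2+2t]≡4[1+t] t′)))
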